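{- Let $\mathcal A,\mathcal B$ be additive categories, and let $\mathcal A^\simeq,\mathcal B^\simeq$ be their groupoid cores with the symmetric monoidal structure given by $\oplus$. A symmetric monoidal functor $F\colon\mathcal A^\simeq\to\mathcal B^\simeq$, with structure isomorphisms $\mu_{X,Y}\colon F(X)\oplus F(Y)\xrightarrow{\sim}F(X\oplus Y)$, extends to an additive functor $\tilde F\colon\mathcal A\to\mathcal B$ (i.e. an additive functor inducing $F$ together with its symmetric monoidal structure on the groupoid cores) if and only if for every $X\in\mathcal A$ one has \[ F\!\begin{pmatrix}1&1\\0&1\end{pmatrix}\circ\mu_{X,X}=\mu_{X,X}\circ\begin{pmatrix}1&1\\0&1\end{pmatrix} \] as maps $F(X)\oplus F(X)\to F(X\oplus X)$. The extension $\tilde F$ is unique if it exists. Moreover, if $\tilde F$ extends $F$ and $\tilde G$ extends $G$, each isomorphism $F\cong G$ of symmetric monoidal functors lifts uniquely to an isomorphism $\tilde F\cong\tilde G$. -}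

module Defs where

open import Level using (Level; _⊔_) renaming (suc to lsuc)
open import Relation.Binary using (Rel; Setoid)
open import Algebra.Structures using (IsAbelianGroup)
open import Algebra.Bundles using (AbelianGroup)
import Algebra.Properties.Group as GroupProps
import Relation.Binary.Reasoning.Setoid as SetoidR

record AdditiveCategory (o ℓ e : Level) : Set (lsuc (o ⊔ ℓ ⊔ e)) where
  infix  4 _≈_
  infixr 9 _∘_
  infixl 6 _+_
  infix  8 -_
  infixr 7 _⊕_
  field
    Obj : Set o
    Hom : Obj → Obj → Set ℓ
    _≈_ : ∀ {X Y} → Rel (Hom X Y) e
    id  : ∀ {X} → Hom X X
    _∘_ : ∀ {X Y Z} → Hom Y Z → Hom X Y → Hom X Z
    _+_ : ∀ {X Y} → Hom X Y → Hom X Y → Hom X Y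
    0h  : ∀ {X Y} → Hom X Y
    -_  : ∀ {X Y} → Hom X Y → Hom X Y
    isAbelianGroup : ∀ {X Y} → IsAbelianGroup (_≈_ {X} {Y}) _+_ 0h -_
    ∘-resp-≈  : ∀ {X Y Z} {f h : Hom Y Z} {g k : Hom X Y} →
                f ≈ h → g ≈ k → f ∘ g ≈ h ∘ k
    identityˡ : ∀ {X Y} {f : Hom X Y} → id ∘ f ≈ f
    identityʳ : ∀ {X Y} {f : Hom X Y} → f ∘ id ≈ f
    assoc     : ∀ {W X Y Z} {f : Hom Y Z} {g : Hom X Y} {h : Hom W X} →
                (f ∘ g) ∘ h ≈ f ∘ (g ∘ h)
    ∘-distribˡ-+ : ∀ {X Y Z} {f : Hom Y Z} {g h : Hom X Y} →
                   f ∘ (g + h) ≈ f ∘ g + f ∘ h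
    ∘-distribʳ-+ : ∀ {X Y Z} {f : Hom X Y} {g h : Hom Y Z} →
                   (g + h) ∘ f ≈ g ∘ f + h ∘ f
    𝟎      : Obj
    𝟎-zero : id {𝟎} ≈ 0h
    _⊕_ : Obj → Obj → Obj
    ι₁  : ∀ {X Y} → Hom X (X ⊕ Y)
    ι₂  : ∀ {X Y} → Hom Y (X ⊕ Y)
    π₁  : ∀ {X Y} → Hom (X ⊕ Y) X
    π₂  : ∀ {X Y} → Hom (X ⊕ Y) Y
    π₁∘ι₁ : ∀ {X Y} → π₁ ∘ ι₁ {X} {Y} ≈ id
    π₂∘ι₂ : ∀ {X Y} → π₂ ∘ ι₂ {X} {Y} ≈ id
    π₁∘ι₂ : ∀ {X Y} → π₁ ∘ ι₂ {X} {Y} ≈ 0h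
    π₂∘ι₁ : ∀ {X Y} → π₂ ∘ ι₁ {X} {Y} ≈ 0h
    ι∘π   : ∀ {X Y} → ι₁ ∘ π₁ + ι₂ ∘ π₂ ≈ id {X ⊕ Y}

module AddCat {o ℓ e : Level} (𝒜 : AdditiveCategory o ℓ e) where
  open AdditiveCategory 𝒜 public

  module G {X Y : Obj} = IsAbelianGroup (isAbelianGroup {X} {Y})

  homAbGroup : Obj → Obj → AbelianGroup ℓ e
  homAbGroup X Y = record { isAbelianGroup = isAbelianGroup {X} {Y} }

  module GP {X Y : Obj} = GroupProps (AbelianGroup.group (homAbGroup X Y))

  homSetoid : Obj → Obj → Setoid ℓ e
  homSetoid X Y = record { isEquivalence = G.isEquivalence {X} {Y} }

  module HR {X Y : Obj} = SetoidR (homSetoid X Y)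

  ≈refl : ∀ {X Y} {f : Hom X Y} → f ≈ f
  ≈refl = G.refl
  ≈sym : ∀ {X Y} {f g : Hom X Y} → f ≈ g → g ≈ f
  ≈sym = G.sym
  ≈trans : ∀ {X Y} {f g h : Hom X Y} → f ≈ g → g ≈ h → f ≈ h
  ≈trans = G.trans
  +-cong : ∀ {X Y} {a b c d : Hom X Y} → a ≈ b → c ≈ d → a + c ≈ b + d
  +-cong = G.∙-cong
  ∘ˡ : ∀ {X Y Z} {f : Hom Y Z} {g h : Hom X Y} → g ≈ h → f ∘ g ≈ f ∘ h
  ∘ˡ p = ∘-resp-≈ ≈refl p
  ∘ʳ : ∀ {X Y Z} {f g : Hom Y Z} {h : Hom X Y} → f ≈ g → f ∘ h ≈ g ∘ h
  ∘ʳ p = ∘-resp-≈ p ≈refl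

  zeroʳ : ∀ {X Y Z} {f : Hom Y Z} → f ∘ 0h {X} {Y} ≈ 0h
  zeroʳ {f = f} = GP.identityˡ-unique (f ∘ 0h) (f ∘ 0h)
    (≈trans (≈sym ∘-distribˡ-+) (∘ˡ (G.identityˡ 0h)))

  zeroˡ : ∀ {X Y Z} {f : Hom X Y} → 0h {Y} {Z} ∘ f ≈ 0h
  zeroˡ {f = f} = GP.identityˡ-unique (0h ∘ f) (0h ∘ f)
    (≈trans (≈sym ∘-distribʳ-+) (∘ʳ (G.identityˡ 0h)))

  neg-∘ : ∀ {X Y Z} {f : Hom Y Z} {g : Hom X Y} → (- f) ∘ g ≈ - (f ∘ g)
  neg-∘ {f = f} {g} = GP.inverseʳ-unique (f ∘ g) ((- f) ∘ g)
    (≈trans (≈sym ∘-distribʳ-+) (≈trans (∘ʳ (G.inverseʳ f)) zeroˡ))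

  into𝟎 : ∀ {X} (f : Hom X 𝟎) → f ≈ 0h
  into𝟎 f = ≈trans (≈sym identityˡ) (≈trans (∘ʳ 𝟎-zero) zeroˡ)

  record Iso (X Y : Obj) : Set (ℓ ⊔ e) where
    field
      from : Hom X Y
      to   : Hom Y X
      isoˡ : to ∘ from ≈ id
      isoʳ : from ∘ to ≈ id

  idᵢ : ∀ {X} → Iso X X
  idᵢ = record { from = id ; to = id ; isoˡ = identityˡ ; isoʳ = identityˡ }

  infixr 9 _∘ᵢ_
  _∘ᵢ_ : ∀ {X Y Z} → Iso Y Z → Iso X Y → Iso X Z
  j ∘ᵢ i = record
    { from = J.from ∘ I.from
    ; to   = I.to ∘ J.to
    ; isoˡ = ≈trans assoc (≈trans (∘ˡ (≈trans (≈sym assoc)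
               (≈trans (∘ʳ J.isoˡ) identityˡ))) I.isoˡ)
    ; isoʳ = ≈trans assoc (≈trans (∘ˡ (≈trans (≈sym assoc)
               (≈trans (∘ʳ I.isoʳ) identityˡ))) J.isoʳ)
    }
    where module I = Iso i
          module J = Iso j

  ⟨_,_⟩ : ∀ {W X Y} → Hom W X → Hom W Y → Hom W (X ⊕ Y)
  ⟨ a , b ⟩ = ι₁ ∘ a + ι₂ ∘ b

  π₁⟨⟩ : ∀ {W X Y} {a : Hom W X} {b : Hom W Y} → π₁ ∘ ⟨ a , b ⟩ ≈ a
  π₁⟨⟩ {a = a} {b} = begin
      π₁ ∘ (ι₁ ∘ a + ι₂ ∘ b)         ≈⟨ ∘-distribˡ-+ ⟩
      π₁ ∘ (ι₁ ∘ a) + π₁ ∘ (ι₂ ∘ b)  ≈⟨ +-cong (≈sym assoc) (≈sym assoc) ⟩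
      (π₁ ∘ ι₁) ∘ a + (π₁ ∘ ι₂) ∘ b  ≈⟨ +-cong (∘ʳ π₁∘ι₁) (∘ʳ π₁∘ι₂) ⟩
      id ∘ a + 0h ∘ b                ≈⟨ +-cong identityˡ zeroˡ ⟩
      a + 0h                         ≈⟨ G.identityʳ a ⟩
      a ∎
    where open HR

  π₂⟨⟩ : ∀ {W X Y} {a : Hom W X} {b : Hom W Y} → π₂ ∘ ⟨ a , b ⟩ ≈ b
  π₂⟨⟩ {a = a} {b} = begin
      π₂ ∘ (ι₁ ∘ a + ι₂ ∘ b)         ≈⟨ ∘-distribˡ-+ ⟩
      π₂ ∘ (ι₁ ∘ a) + π₂ ∘ (ι₂ ∘ b)  ≈⟨ +-cong (≈sym assoc) (≈sym assoc) ⟩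
      (π₂ ∘ ι₁) ∘ a + (π₂ ∘ ι₂) ∘ b  ≈⟨ +-cong (∘ʳ π₂∘ι₁) (∘ʳ π₂∘ι₂) ⟩
      0h ∘ a + id ∘ b                ≈⟨ +-cong zeroˡ identityˡ ⟩
      0h + b                         ≈⟨ G.identityˡ b ⟩
      b ∎
    where open HR

  π₁⟨⟩∘ : ∀ {V W X Y} {a : Hom W X} {b : Hom W Y} {h : Hom V W} →
          π₁ ∘ (⟨ a , b ⟩ ∘ h) ≈ a ∘ h
  π₁⟨⟩∘ = ≈trans (≈sym assoc) (∘ʳ π₁⟨⟩)

  π₂⟨⟩∘ : ∀ {V W X Y} {a : Hom W X} {b : Hom W Y} {h : Hom V W} →
          π₂ ∘ (⟨ a , b ⟩ ∘ h) ≈ b ∘ h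
  π₂⟨⟩∘ = ≈trans (≈sym assoc) (∘ʳ π₂⟨⟩)

  expand : ∀ {W X Y} (h : Hom W (X ⊕ Y)) → h ≈ ⟨ π₁ ∘ h , π₂ ∘ h ⟩
  expand h = begin
      h                                ≈⟨ ≈sym identityˡ ⟩
      id ∘ h                           ≈⟨ ∘ʳ (≈sym ι∘π) ⟩
      (ι₁ ∘ π₁ + ι₂ ∘ π₂) ∘ h          ≈⟨ ∘-distribʳ-+ ⟩
      (ι₁ ∘ π₁) ∘ h + (ι₂ ∘ π₂) ∘ h    ≈⟨ +-cong assoc assoc ⟩
      ι₁ ∘ (π₁ ∘ h) + ι₂ ∘ (π₂ ∘ h) ∎
    where open HR

  ext : ∀ {W X Y} {h k : Hom W (X ⊕ Y)} →
        π₁ ∘ h ≈ π₁ ∘ k → π₂ ∘ h ≈ π₂ ∘ k → h ≈ k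
  ext {h = h} {k} p q =
    ≈trans (expand h) (≈trans (+-cong (∘ˡ p) (∘ˡ q)) (≈sym (expand k)))

  ext-id : ∀ {X Y} {h : Hom (X ⊕ Y) (X ⊕ Y)} →
           π₁ ∘ h ≈ π₁ → π₂ ∘ h ≈ π₂ → h ≈ id
  ext-id p q = ext (≈trans p (≈sym identityʳ)) (≈trans q (≈sym identityʳ))

  ext-pair : ∀ {W X Y} {h : Hom W (X ⊕ Y)} {a : Hom W X} {b : Hom W Y} →
             π₁ ∘ h ≈ a → π₂ ∘ h ≈ b → h ≈ ⟨ a , b ⟩
  ext-pair p q = ext (≈trans p (≈sym π₁⟨⟩)) (≈trans q (≈sym π₂⟨⟩))

  infixr 7 _⊕₁_
  _⊕₁_ : ∀ {X X' Y Y'} → Hom X X' → Hom Y Y' → Hom (X ⊕ Y) (X' ⊕ Y')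
  f ⊕₁ g = ⟨ f ∘ π₁ , g ∘ π₂ ⟩

  ⊕₁-cong : ∀ {X X' Y Y'} {f f' : Hom X X'} {g g' : Hom Y Y'} →
            f ≈ f' → g ≈ g' → f ⊕₁ g ≈ f' ⊕₁ g'
  ⊕₁-cong p q = +-cong (∘ˡ (∘ʳ p)) (∘ˡ (∘ʳ q))

  ⊕₁-∘ : ∀ {X X' X'' Y Y' Y''} {f : Hom X' X''} {f' : Hom X X'}
           {g : Hom Y' Y''} {g' : Hom Y Y'} →
         (f ⊕₁ g) ∘ (f' ⊕₁ g') ≈ (f ∘ f') ⊕₁ (g ∘ g')
  ⊕₁-∘ = ext-pair
    (≈trans π₁⟨⟩∘ (≈trans assoc (≈trans (∘ˡ π₁⟨⟩) (≈sym assoc))))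
    (≈trans π₂⟨⟩∘ (≈trans assoc (≈trans (∘ˡ π₂⟨⟩) (≈sym assoc))))

  ⊕₁-id : ∀ {X Y} → id {X} ⊕₁ id {Y} ≈ id
  ⊕₁-id = ext-id (≈trans π₁⟨⟩ identityˡ) (≈trans π₂⟨⟩ identityˡ)

  infixr 7 _⊕ᵢ_
  _⊕ᵢ_ : ∀ {X X' Y Y'} → Iso X X' → Iso Y Y' → Iso (X ⊕ Y) (X' ⊕ Y')
  i ⊕ᵢ j = record
    { from = I.from ⊕₁ J.from
    ; to   = I.to ⊕₁ J.to
    ; isoˡ = ≈trans ⊕₁-∘ (≈trans (⊕₁-cong I.isoˡ J.isoˡ) ⊕₁-id)
    ; isoʳ = ≈trans ⊕₁-∘ (≈trans (⊕₁-cong I.isoʳ J.isoʳ) ⊕₁-id)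
    }
    where module I = Iso i
          module J = Iso j

  αʳ : ∀ {X Y Z} → Hom ((X ⊕ Y) ⊕ Z) (X ⊕ (Y ⊕ Z))
  αʳ = ⟨ π₁ ∘ π₁ , ⟨ π₂ ∘ π₁ , π₂ ⟩ ⟩

  αˡ : ∀ {X Y Z} → Hom (X ⊕ (Y ⊕ Z)) ((X ⊕ Y) ⊕ Z)
  αˡ = ⟨ ⟨ π₁ , π₁ ∘ π₂ ⟩ , π₂ ∘ π₂ ⟩

  assocᵢ : ∀ X Y Z → Iso ((X ⊕ Y) ⊕ Z) (X ⊕ (Y ⊕ Z))
  assocᵢ X Y Z = record
    { from = αʳ
    ; to   = αˡ
    ; isoˡ = ext-id
        (≈trans π₁⟨⟩∘ (ext
           (≈trans π₁⟨⟩∘ π₁⟨⟩)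
           (≈trans π₂⟨⟩∘ (≈trans assoc (≈trans (∘ˡ π₂⟨⟩) π₁⟨⟩)))))
        (≈trans π₂⟨⟩∘ (≈trans assoc (≈trans (∘ˡ π₂⟨⟩) π₂⟨⟩)))
    ; isoʳ = ext-id
        (≈trans π₁⟨⟩∘ (≈trans assoc (≈trans (∘ˡ π₁⟨⟩) π₁⟨⟩)))
        (≈trans π₂⟨⟩∘ (ext
           (≈trans π₁⟨⟩∘ (≈trans assoc (≈trans (∘ˡ π₁⟨⟩) π₂⟨⟩)))
           (≈trans π₂⟨⟩∘ π₂⟨⟩)))
    }

  σ : ∀ {X Y} → Hom (X ⊕ Y) (Y ⊕ X)
  σ = ⟨ π₂ , π₁ ⟩

  σᵢ : ∀ X Y → Iso (X ⊕ Y) (Y ⊕ X)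
  σᵢ X Y = record
    { from = σ
    ; to   = σ
    ; isoˡ = ext-id (≈trans π₁⟨⟩∘ π₂⟨⟩) (≈trans π₂⟨⟩∘ π₁⟨⟩)
    ; isoʳ = ext-id (≈trans π₁⟨⟩∘ π₂⟨⟩) (≈trans π₂⟨⟩∘ π₁⟨⟩)
    }

  λᵢ : ∀ X → Iso (𝟎 ⊕ X) X
  λᵢ X = record
    { from = π₂
    ; to   = ι₂
    ; isoˡ = ext-id
        (≈trans (into𝟎 _) (≈sym (into𝟎 _)))
        (≈trans (≈sym assoc) (≈trans (∘ʳ π₂∘ι₂) identityˡ))
    ; isoʳ = π₂∘ι₂
    }

  ρᵢ : ∀ X → Iso (X ⊕ 𝟎) X
  ρᵢ X = record
    { from = π₁
    ; to   = ι₁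
    ; isoˡ = ext-id
        (≈trans (≈sym assoc) (≈trans (∘ʳ π₁∘ι₁) identityˡ))
        (≈trans (into𝟎 _) (≈sym (into𝟎 _)))
    ; isoʳ = π₁∘ι₁
    }

  -- the shear map  (1 1; 0 1) : X ⊕ X → X ⊕ X  (matrices act on columns:
  -- π₁ ∘ shear = π₁ + π₂ ,  π₂ ∘ shear = π₂)
  shear : ∀ {X} → Hom (X ⊕ X) (X ⊕ X)
  shear = ⟨ π₁ + π₂ , π₂ ⟩

  shear⁻¹ : ∀ {X} → Hom (X ⊕ X) (X ⊕ X)
  shear⁻¹ = ⟨ π₁ + - π₂ , π₂ ⟩

  shearᵢ : ∀ X → Iso (X ⊕ X) (X ⊕ X)
  shearᵢ X = record
    { from = shear
    ; to   = shear⁻¹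
    ; isoˡ = ext-id
        (begin
          π₁ ∘ (shear⁻¹ ∘ shear)                  ≈⟨ π₁⟨⟩∘ ⟩
          (π₁ + - π₂) ∘ shear                    ≈⟨ ∘-distribʳ-+ ⟩
          π₁ ∘ shear + (- π₂) ∘ shear            ≈⟨ +-cong π₁⟨⟩ (≈trans neg-∘ (G.⁻¹-cong π₂⟨⟩)) ⟩
          (π₁ + π₂) + - π₂                       ≈⟨ G.assoc π₁ π₂ (- π₂) ⟩
          π₁ + (π₂ + - π₂)                       ≈⟨ +-cong ≈refl (G.inverseʳ π₂) ⟩
          π₁ + 0h                                ≈⟨ G.identityʳ π₁ ⟩
          π₁ ∎)
        (≈trans π₂⟨⟩∘ π₂⟨⟩)
    ; isoʳ = ext-id
        (begin
          π₁ ∘ (shear ∘ shear⁻¹)                  ≈⟨ π₁⟨⟩∘ ⟩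
          (π₁ + π₂) ∘ shear⁻¹                    ≈⟨ ∘-distribʳ-+ ⟩
          π₁ ∘ shear⁻¹ + π₂ ∘ shear⁻¹            ≈⟨ +-cong π₁⟨⟩ π₂⟨⟩ ⟩
          (π₁ + - π₂) + π₂                       ≈⟨ G.assoc π₁ (- π₂) π₂ ⟩
          π₁ + (- π₂ + π₂)                       ≈⟨ +-cong ≈refl (G.inverseˡ π₂) ⟩
          π₁ + 0h                                ≈⟨ G.identityʳ π₁ ⟩
          π₁ ∎)
        (≈trans π₂⟨⟩∘ π₂⟨⟩)
    }
    where open HR

module _ {o ℓ e o' ℓ' e' : Level}
         (𝒜 : AdditiveCategory o ℓ e) (ℬ : AdditiveCategory o' ℓ' e') where

  private
    module A = AddCat 𝒜
    module B = AddCat ℬ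

  -- Morphisms of the core 𝒜^≃ are isomorphisms of 𝒜; F sends them to
  -- morphisms of ℬ (which are then automatically isomorphisms).
  record SymMonCoreFunctor : Set (o ⊔ ℓ ⊔ e ⊔ o' ⊔ ℓ' ⊔ e') where
    field
      F₀     : A.Obj → B.Obj
      F₁     : ∀ {X Y} → A.Iso X Y → B.Hom (F₀ X) (F₀ Y)
      F-resp : ∀ {X Y} {i j : A.Iso X Y} →
               A.Iso.from i A.≈ A.Iso.from j → F₁ i B.≈ F₁ j
      F-id   : ∀ {X} → F₁ (A.idᵢ {X}) B.≈ B.id
      F-∘    : ∀ {X Y Z} (j : A.Iso Y Z) (i : A.Iso X Y) →
               F₁ (j A.∘ᵢ i) B.≈ F₁ j B.∘ F₁ i
      μ : ∀ X Y → B.Iso (F₀ X B.⊕ F₀ Y) (F₀ (X A.⊕ Y))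
      ε : B.Iso B.𝟎 (F₀ A.𝟎)
      μ-natural : ∀ {X X' Y Y'} (f : A.Iso X X') (g : A.Iso Y Y') →
        F₁ (f A.⊕ᵢ g) B.∘ B.Iso.from (μ X Y)
          B.≈ B.Iso.from (μ X' Y') B.∘ (F₁ f B.⊕₁ F₁ g)
      assoc-coh : ∀ X Y Z →
        F₁ (A.assocᵢ X Y Z) B.∘ (B.Iso.from (μ (X A.⊕ Y) Z)
                                   B.∘ (B.Iso.from (μ X Y) B.⊕₁ B.id))
          B.≈ B.Iso.from (μ X (Y A.⊕ Z))
                B.∘ ((B.id B.⊕₁ B.Iso.from (μ Y Z)) B.∘ B.αʳ)
      unitˡ-coh : ∀ X →
        F₁ (A.λᵢ X) B.∘ (B.Iso.from (μ A.𝟎 X)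
                           B.∘ (B.Iso.from ε B.⊕₁ B.id))
          B.≈ B.π₂
      unitʳ-coh : ∀ X →
        F₁ (A.ρᵢ X) B.∘ (B.Iso.from (μ X A.𝟎)
                           B.∘ (B.id B.⊕₁ B.Iso.from ε))
          B.≈ B.π₁
      braid-coh : ∀ X Y →
        F₁ (A.σᵢ X Y) B.∘ B.Iso.from (μ X Y)
          B.≈ B.Iso.from (μ Y X) B.∘ B.σ

  open SymMonCoreFunctor

  ShearCondition : SymMonCoreFunctor → Set (o ⊔ e')
  ShearCondition F = ∀ X →
    F₁ F (A.shearᵢ X) B.∘ B.Iso.from (μ F X X)
      B.≈ B.Iso.from (μ F X X) B.∘ B.shear

  -- An additive functor  F̃ : 𝒜 → ℬ  extending F: on objects it is F₀,
  -- on isomorphisms it agrees with F₁, and its induced monoidal structure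
  -- F̃ X ⊕ F̃ Y → F̃ (X ⊕ Y),  i.e.  F̃ι₁ ∘ π₁ + F̃ι₂ ∘ π₂,  is μ_{X,Y}.
  record Extension (F : SymMonCoreFunctor) : Set (o ⊔ ℓ ⊔ e ⊔ ℓ' ⊔ e') where
    field
      map       : ∀ {X Y} → A.Hom X Y → B.Hom (F₀ F X) (F₀ F Y)
      map-resp  : ∀ {X Y} {f g : A.Hom X Y} → f A.≈ g → map f B.≈ map g
      map-id    : ∀ {X} → map (A.id {X}) B.≈ B.id
      map-∘     : ∀ {X Y Z} (g : A.Hom Y Z) (f : A.Hom X Y) →
                  map (g A.∘ f) B.≈ map g B.∘ map f
      map-+     : ∀ {X Y} (f g : A.Hom X Y) →
                  map (f A.+ g) B.≈ map f B.+ map g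
      map-iso   : ∀ {X Y} (i : A.Iso X Y) → map (A.Iso.from i) B.≈ F₁ F i
      map-μ     : ∀ X Y →
                  map (A.ι₁ {X} {Y}) B.∘ B.π₁ B.+ map (A.ι₂ {X} {Y}) B.∘ B.π₂
                    B.≈ B.Iso.from (μ F X Y)

  record MonNatIso (F G : SymMonCoreFunctor) : Set (o ⊔ ℓ ⊔ e ⊔ ℓ' ⊔ e') where
    field
      η       : ∀ X → B.Iso (F₀ F X) (F₀ G X)
      natural : ∀ {X Y} (f : A.Iso X Y) →
                F₁ G f B.∘ B.Iso.from (η X) B.≈ B.Iso.from (η Y) B.∘ F₁ F f
      η-μ     : ∀ X Y →
                B.Iso.from (η (X A.⊕ Y)) B.∘ B.Iso.from (μ F X Y)
                  B.≈ B.Iso.from (μ G X Y)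
                        B.∘ (B.Iso.from (η X) B.⊕₁ B.Iso.from (η Y))
      η-ε     : B.Iso.from (η A.𝟎) B.∘ B.Iso.from (ε F) B.≈ B.Iso.from (ε G)

  record NatIsoExt {F G : SymMonCoreFunctor}
                   (E : Extension F) (E' : Extension G)
                   : Set (o ⊔ ℓ ⊔ e ⊔ ℓ' ⊔ e') where
    field
      β       : ∀ X → B.Iso (F₀ F X) (F₀ G X)
      natural : ∀ {X Y} (f : A.Hom X Y) →
                Extension.map E' f B.∘ B.Iso.from (β X)
                  B.≈ B.Iso.from (β Y) B.∘ Extension.map E f

  IsLiftOf : {F G : SymMonCoreFunctor} {E : Extension F} {E' : Extension G} →
             NatIsoExt E E' → MonNatIso F G → Set (o ⊔ e')
  IsLiftOf β η = ∀ X →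
    B.Iso.from (NatIsoExt.β β X) B.≈ B.Iso.from (MonNatIso.η η X)

{-# OPTIONS --safe #-}
module Submission where

-- For f : X → Y let elem f be the elementary automorphism (1 0; f 1) of X ⊕ Y, whose lower-left
-- entry is f. An additive extension F̃ must send f to the lower-left entry of F (elem f) read in
-- the coordinates μ; this forces uniqueness of F̃, and of a lift of η, which can only be η itself.
-- Conversely, define F̃ f by that formula. The Steinberg relation e₃₂(g) e₂₁(f) = e₃₁(g f)
-- e₂₁(f) e₃₂(g) on X ⊕ Y ⊕ Z is built from ⊕, α and σ, so the coherences of μ transport it
-- through F. Taking g = id, where the shear condition says that F (elem id) is elem id in the
-- coordinates μ, it forces F (elem f) to be elem (F̃ f) in those coordinates. After that,
-- elem f ∘ elem g = elem (f + g) gives additivity, the Steinberg relation gives functoriality,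
-- and writing elem ι₁ and σ through the monoidal structure gives compatibility with μ.

open import Level using (Level)
open import Data.Product using (Σ; _×_; _,_)
open import Defs

module Biproducts {o ℓ e : Level} (𝒞 : AdditiveCategory o ℓ e) where
  open AddCat 𝒞 public

  symᵢ : ∀ {X Y} → Iso X Y → Iso Y X
  symᵢ i = record
    { from = Iso.to i ; to = Iso.from i ; isoˡ = Iso.isoʳ i ; isoʳ = Iso.isoˡ i }

  act-∘ : ∀ {U V W Z} {f : Hom W Z} {g : Hom V W} {v : Hom U V} {w : Hom U W} {z : Hom U Z} →
          g ∘ v ≈ w → f ∘ w ≈ z → (f ∘ g) ∘ v ≈ z
  act-∘ p q = ≈trans assoc (≈trans (∘ˡ p) q)

  extendʳ : ∀ {U V W W' Z} {a : Hom W Z} {b : Hom V W} {c : Hom W' Z} {d : Hom V W'}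
              {x : Hom U V} →
            a ∘ b ≈ c ∘ d → a ∘ (b ∘ x) ≈ c ∘ (d ∘ x)
  extendʳ p = ≈trans (≈sym assoc) (≈trans (∘ʳ p) assoc)

  cancelˡ : ∀ {U V W} {h : Hom V U} {i : Hom U V} {f : Hom W U} →
            h ∘ i ≈ id → h ∘ (i ∘ f) ≈ f
  cancelˡ p = ≈trans (≈sym assoc) (≈trans (∘ʳ p) identityˡ)

  cancelʳ : ∀ {U V W} {h : Hom V U} {i : Hom U V} {f : Hom U W} →
            h ∘ i ≈ id → (f ∘ h) ∘ i ≈ f
  cancelʳ p = ≈trans assoc (≈trans (∘ˡ p) identityʳ)

  cancelʳ-id : ∀ {X Y} {e : Hom X X} {h k : Hom X Y} → e ≈ id → h ∘ e ≈ k ∘ e → h ≈ k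
  cancelʳ-id e≈id p = ≈trans (≈sym identityʳ) (≈trans (∘ˡ (≈sym e≈id))
                        (≈trans p (≈trans (∘ˡ e≈id) identityʳ)))

  idempotent-split-epi⇒id : ∀ {X} {a a' : Hom X X} →
                        a ∘ a ≈ a → a ∘ a' ≈ id → a ≈ id
  idempotent-split-epi⇒id {a = a} {a'} aa≈a aa'≈id = begin
      a             ≈⟨ ≈sym identityʳ ⟩
      a ∘ id        ≈⟨ ∘ˡ (≈sym aa'≈id) ⟩
      a ∘ (a ∘ a')  ≈⟨ ≈sym assoc ⟩
      (a ∘ a) ∘ a'  ≈⟨ ∘ʳ aa≈a ⟩
      a ∘ a'        ≈⟨ aa'≈id ⟩
      id            ∎
    where open HR

  ⟨⟩-cong : ∀ {W X Y} {a a' : Hom W X} {b b' : Hom W Y} →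
            a ≈ a' → b ≈ b' → ⟨ a , b ⟩ ≈ ⟨ a' , b' ⟩
  ⟨⟩-cong p q = +-cong (∘ˡ p) (∘ˡ q)

  ⟨⟩-injectiveˡ : ∀ {W X Y} {a a' : Hom W X} {b b' : Hom W Y} →
                  ⟨ a , b ⟩ ≈ ⟨ a' , b' ⟩ → a ≈ a'
  ⟨⟩-injectiveˡ p = ≈trans (≈sym π₁⟨⟩) (≈trans (∘ˡ p) π₁⟨⟩)

  ⟨⟩-injectiveʳ : ∀ {W X Y} {a a' : Hom W X} {b b' : Hom W Y} →
                  ⟨ a , b ⟩ ≈ ⟨ a' , b' ⟩ → b ≈ b'
  ⟨⟩-injectiveʳ p = ≈trans (≈sym π₂⟨⟩) (≈trans (∘ˡ p) π₂⟨⟩)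

  ⟨⟩∘ : ∀ {V W X Y} {a : Hom W X} {b : Hom W Y} {h : Hom V W} →
        ⟨ a , b ⟩ ∘ h ≈ ⟨ a ∘ h , b ∘ h ⟩
  ⟨⟩∘ = ≈trans ∘-distribʳ-+ (+-cong assoc assoc)

  ⟨⟩-+ : ∀ {W X Y} {a a' : Hom W X} {b b' : Hom W Y} →
         ⟨ a , b ⟩ + ⟨ a' , b' ⟩ ≈ ⟨ a + a' , b + b' ⟩
  ⟨⟩-+ = ext-pair (≈trans ∘-distribˡ-+ (+-cong π₁⟨⟩ π₁⟨⟩))
                  (≈trans ∘-distribˡ-+ (+-cong π₂⟨⟩ π₂⟨⟩))

  0≈⟨0,0⟩ : ∀ {W X Y} → 0h {W} {X ⊕ Y} ≈ ⟨ 0h , 0h ⟩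
  0≈⟨0,0⟩ = ext-pair zeroʳ zeroʳ

  ι₁∘ : ∀ {W X Y} {a : Hom W X} → ι₁ {X} {Y} ∘ a ≈ ⟨ a , 0h ⟩
  ι₁∘ = ext-pair (cancelˡ π₁∘ι₁) (≈trans (≈sym assoc) (≈trans (∘ʳ π₂∘ι₁) zeroˡ))

  ι₁-⟨⟩ : ∀ {X Y} → ι₁ {X} {Y} ≈ ⟨ id , 0h ⟩
  ι₁-⟨⟩ = ≈trans (≈sym identityʳ) ι₁∘

  ι₂-⟨⟩ : ∀ {X Y} → ι₂ {X} {Y} ≈ ⟨ 0h , id ⟩
  ι₂-⟨⟩ = ext-pair π₁∘ι₂ π₂∘ι₂

  ⊕₁∘⟨⟩ : ∀ {V X X' Y Y'} {f : Hom X X'} {g : Hom Y Y'} {a : Hom V X} {b : Hom V Y} →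
          (f ⊕₁ g) ∘ ⟨ a , b ⟩ ≈ ⟨ f ∘ a , g ∘ b ⟩
  ⊕₁∘⟨⟩ = ext-pair (≈trans π₁⟨⟩∘ (≈trans assoc (∘ˡ π₁⟨⟩)))
                   (≈trans π₂⟨⟩∘ (≈trans assoc (∘ˡ π₂⟨⟩)))

  ⊕₁∘ι₁ : ∀ {X X' Y Y'} {f : Hom X X'} {g : Hom Y Y'} → (f ⊕₁ g) ∘ ι₁ ≈ ι₁ ∘ f
  ⊕₁∘ι₁ = ≈trans (∘ˡ ι₁-⟨⟩) (≈trans ⊕₁∘⟨⟩ (≈trans (⟨⟩-cong identityʳ zeroʳ) (≈sym ι₁∘)))

  π₂∘⊕₁ : ∀ {V X X' Y Y'} {f : Hom X X'} {g : Hom Y Y'} {v : Hom V (X ⊕ Y)} →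
          π₂ ∘ ((f ⊕₁ g) ∘ v) ≈ g ∘ (π₂ ∘ v)
  π₂∘⊕₁ = ≈trans π₂⟨⟩∘ assoc

  αʳ∘⟨⟩ : ∀ {V X Y Z} {a : Hom V X} {b : Hom V Y} {c : Hom V Z} →
          αʳ ∘ ⟨ ⟨ a , b ⟩ , c ⟩ ≈ ⟨ a , ⟨ b , c ⟩ ⟩
  αʳ∘⟨⟩ = ext-pair (≈trans π₁⟨⟩∘ (≈trans assoc (≈trans (∘ˡ π₁⟨⟩) π₁⟨⟩)))
            (≈trans π₂⟨⟩∘ (ext-pair (≈trans π₁⟨⟩∘ (≈trans assoc (≈trans (∘ˡ π₁⟨⟩) π₂⟨⟩)))
                                    (≈trans π₂⟨⟩∘ π₂⟨⟩)))

  αˡ∘⟨⟩ : ∀ {V X Y Z} {a : Hom V X} {b : Hom V Y} {c : Hom V Z} →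
          αˡ ∘ ⟨ a , ⟨ b , c ⟩ ⟩ ≈ ⟨ ⟨ a , b ⟩ , c ⟩
  αˡ∘⟨⟩ = ext-pair (≈trans π₁⟨⟩∘ (ext-pair (≈trans π₁⟨⟩∘ π₁⟨⟩)
                     (≈trans π₂⟨⟩∘ (≈trans assoc (≈trans (∘ˡ π₂⟨⟩) π₁⟨⟩)))))
                   (≈trans π₂⟨⟩∘ (≈trans assoc (≈trans (∘ˡ π₂⟨⟩) π₂⟨⟩)))

  σ∘⟨⟩ : ∀ {V X Y} {a : Hom V X} {b : Hom V Y} → σ ∘ ⟨ a , b ⟩ ≈ ⟨ b , a ⟩
  σ∘⟨⟩ = ext-pair (≈trans π₁⟨⟩∘ π₂⟨⟩) (≈trans π₂⟨⟩∘ π₁⟨⟩)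

  shear∘⟨⟩ : ∀ {V X} {a b : Hom V X} → shear ∘ ⟨ a , b ⟩ ≈ ⟨ a + b , b ⟩
  shear∘⟨⟩ = ext-pair (≈trans π₁⟨⟩∘ (≈trans ∘-distribʳ-+ (+-cong π₁⟨⟩ π₂⟨⟩)))
                      (≈trans π₂⟨⟩∘ π₂⟨⟩)

  ⟨⟨π₁∘π₁,π₂∘π₁⟩,π₂⟩≈id : ∀ {X Y Z} → ⟨ ⟨ π₁ ∘ π₁ , π₂ ∘ π₁ ⟩ , π₂ ⟩ ≈ id {(X ⊕ Y) ⊕ Z}
  ⟨⟨π₁∘π₁,π₂∘π₁⟩,π₂⟩≈id = ≈trans (⟨⟩-cong (≈sym (expand π₁)) ≈refl) ι∘π

  ⟨π₁,⟨π₁∘π₂,π₂∘π₂⟩⟩≈id : ∀ {X Y Z} → ⟨ π₁ , ⟨ π₁ ∘ π₂ , π₂ ∘ π₂ ⟩ ⟩ ≈ id {X ⊕ (Y ⊕ Z)}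
  ⟨π₁,⟨π₁∘π₂,π₂∘π₂⟩⟩≈id = ≈trans (⟨⟩-cong ≈refl (≈sym (expand π₂))) ι∘π

  infix 5 [_,_]
  [_,_] : ∀ {X Y Z} → Hom X Z → Hom Y Z → Hom (X ⊕ Y) Z
  [ u , v ] = u ∘ π₁ + v ∘ π₂

  []-η : ∀ {X Y Z} (k : Hom (X ⊕ Y) Z) → k ≈ [ k ∘ ι₁ , k ∘ ι₂ ]
  []-η k = ≈trans (≈sym identityʳ) (≈trans (∘ˡ (≈sym ι∘π))
             (≈trans ∘-distribˡ-+ (+-cong (≈sym assoc) (≈sym assoc))))

  ∘[] : ∀ {X Y Z W} {h : Hom Z W} {u : Hom X Z} {v : Hom Y Z} →
        h ∘ [ u , v ] ≈ [ h ∘ u , h ∘ v ]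
  ∘[] = ≈trans ∘-distribˡ-+ (+-cong (≈sym assoc) (≈sym assoc))

  ∘-[]-η : ∀ {X Y Z W} (p : Hom Z W) (M : Hom (X ⊕ Y) Z) →
           p ∘ M ≈ [ p ∘ (M ∘ ι₁) , p ∘ (M ∘ ι₂) ]
  ∘-[]-η p M = ≈trans ([]-η _) (+-cong (∘ʳ assoc) (∘ʳ assoc))

  []∘⟨⟩ : ∀ {V X Y Z} {u : Hom X Z} {v : Hom Y Z} {a : Hom V X} {b : Hom V Y} →
          [ u , v ] ∘ ⟨ a , b ⟩ ≈ u ∘ a + v ∘ b
  []∘⟨⟩ = ≈trans ∘-distribʳ-+ (+-cong (≈trans assoc (∘ˡ π₁⟨⟩)) (≈trans assoc (∘ˡ π₂⟨⟩)))

  []-cong : ∀ {X Y Z} {u u' : Hom X Z} {v v' : Hom Y Z} → u ≈ u' → v ≈ v' → [ u , v ] ≈ [ u' , v' ]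
  []-cong p q = +-cong (∘ʳ p) (∘ʳ q)

  []∘ι₁ : ∀ {X Y Z} {u : Hom X Z} {v : Hom Y Z} → [ u , v ] ∘ ι₁ ≈ u
  []∘ι₁ = ≈trans (∘ˡ ι₁-⟨⟩) (≈trans []∘⟨⟩ (≈trans (+-cong identityʳ zeroʳ) (G.identityʳ _)))

  []∘shear : ∀ {X Z} {u v : Hom X Z} → [ u , v ] ∘ shear ≈ [ u , u + v ]
  []∘shear = ≈trans []∘⟨⟩ (≈trans (+-cong ∘-distribˡ-+ ≈refl)
    (≈trans (G.assoc _ _ _) (+-cong ≈refl (≈sym ∘-distribʳ-+))))

  elem : ∀ {X Y} → Hom X Y → Hom (X ⊕ Y) (X ⊕ Y)
  elem f = ⟨ π₁ , f ∘ π₁ + π₂ ⟩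

  elem-cong : ∀ {X Y} {f g : Hom X Y} → f ≈ g → elem f ≈ elem g
  elem-cong p = ⟨⟩-cong ≈refl (+-cong (∘ʳ p) ≈refl)

  elem∘⟨⟩ : ∀ {V X Y} {f : Hom X Y} {a : Hom V X} {b : Hom V Y} →
            elem f ∘ ⟨ a , b ⟩ ≈ ⟨ a , f ∘ a + b ⟩
  elem∘⟨⟩ = ext-pair (≈trans π₁⟨⟩∘ π₁⟨⟩)
    (≈trans π₂⟨⟩∘ (≈trans ∘-distribʳ-+ (+-cong (≈trans assoc (∘ˡ π₁⟨⟩)) π₂⟨⟩)))

  elem-+ : ∀ {X Y} {f g : Hom X Y} → elem f ∘ elem g ≈ elem (f + g)
  elem-+ = cancelʳ-id ι∘π (≈trans (act-∘ elem∘⟨⟩ elem∘⟨⟩)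
    (≈trans (⟨⟩-cong ≈refl (≈trans (≈sym (G.assoc _ _ _)) (+-cong (≈sym ∘-distribʳ-+) ≈refl)))
      (≈sym elem∘⟨⟩)))

  elem-0 : ∀ {X Y} → elem (0h {X} {Y}) ≈ id
  elem-0 = ≈trans (⟨⟩-cong ≈refl (≈trans (+-cong zeroˡ ≈refl) (G.identityˡ _))) ι∘π

  elemᵢ : ∀ {X Y} → Hom X Y → Iso (X ⊕ Y) (X ⊕ Y)
  elemᵢ f = record
    { from = elem f
    ; to   = elem (- f)
    ; isoˡ = ≈trans elem-+ (≈trans (elem-cong (G.inverseˡ f)) elem-0)
    ; isoʳ = ≈trans elem-+ (≈trans (elem-cong (G.inverseʳ f)) elem-0)
    }

  π₂∘elem∘ι₁ : ∀ {X Y} {f : Hom X Y} → π₂ ∘ (elem f ∘ ι₁) ≈ f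
  π₂∘elem∘ι₁ = ≈trans (∘ˡ (≈trans (∘ˡ ι₁-⟨⟩) elem∘⟨⟩))
                 (≈trans π₂⟨⟩ (≈trans (+-cong identityʳ ≈refl) (G.identityʳ _)))

  σ∘shear∘σ : ∀ {X} → σ ∘ (shear ∘ σ) ≈ elem (id {X})
  σ∘shear∘σ = cancelʳ-id ι∘π (≈trans (act-∘ (act-∘ σ∘⟨⟩ shear∘⟨⟩) σ∘⟨⟩)
    (≈trans (⟨⟩-cong ≈refl (≈trans (G.comm _ _) (+-cong (≈sym identityˡ) ≈refl)))
      (≈sym elem∘⟨⟩)))

  elem-conj : ∀ {X Y Y'} {g : Hom Y Y'} {k : Hom Y' Y} {f : Hom X Y} → g ∘ k ≈ id →
              (id ⊕₁ g) ∘ (elem f ∘ (id ⊕₁ k)) ≈ elem (g ∘ f)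
  elem-conj gk≈id = cancelʳ-id ι∘π (≈trans (act-∘ (act-∘ ⊕₁∘⟨⟩ elem∘⟨⟩) ⊕₁∘⟨⟩)
    (≈trans (⟨⟩-cong (≈trans identityˡ identityˡ)
      (≈trans ∘-distribˡ-+ (+-cong (≈trans (∘ˡ (∘ˡ identityˡ)) (≈sym assoc)) (cancelˡ gk≈id))))
      (≈sym elem∘⟨⟩)))

  elem-ι₁ : ∀ {X Y} → elem (ι₁ {X} {Y}) ≈ αʳ ∘ ((elem id ⊕₁ id) ∘ αˡ)
  elem-ι₁ = cancelʳ-id ⟨π₁,⟨π₁∘π₂,π₂∘π₂⟩⟩≈id (≈trans elem∘⟨⟩
    (≈trans (⟨⟩-cong ≈refl ι₁-on-⟨⟩)
      (≈sym (act-∘ (act-∘ αˡ∘⟨⟩ (≈trans ⊕₁∘⟨⟩ (⟨⟩-cong elem∘⟨⟩ ≈refl))) αʳ∘⟨⟩))))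
    where
    ι₁-on-⟨⟩ : ∀ {V X Y} {a b : Hom V X} {c : Hom V Y} →
               ι₁ ∘ a + ⟨ b , c ⟩ ≈ ⟨ id ∘ a + b , id ∘ c ⟩
    ι₁-on-⟨⟩ = ≈trans (+-cong ι₁∘ ≈refl) (≈trans ⟨⟩-+
      (⟨⟩-cong (+-cong (≈sym identityˡ) ≈refl) (≈trans (G.identityˡ _) (≈sym identityˡ))))

  shear∘ι₁ : ∀ {X} → shear ∘ ι₁ ≈ ι₁ {X} {X}
  shear∘ι₁ = ≈trans (∘ˡ ι₁-⟨⟩)
    (≈trans shear∘⟨⟩ (≈trans (⟨⟩-cong (G.identityʳ _) ≈refl) (≈sym ι₁-⟨⟩)))

  shear∘ι₂ : ∀ {X} → shear ∘ ι₂ ≈ ι₁ {X} {X} + ι₂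
  shear∘ι₂ = ≈trans (∘ˡ ι₂-⟨⟩) (≈trans shear∘⟨⟩
    (≈trans (⟨⟩-cong (G.identityˡ _) ≈refl) (+-cong identityʳ identityʳ)))

  σ∘ι₁ : ∀ {X Y} → σ ∘ ι₁ ≈ ι₂ {X} {Y}
  σ∘ι₁ = ≈trans (∘ˡ ι₁-⟨⟩) (≈trans σ∘⟨⟩ (≈sym ι₂-⟨⟩))

  on₁₂ : ∀ {X Y W} → Hom (X ⊕ Y) (X ⊕ Y) → Hom ((X ⊕ Y) ⊕ W) ((X ⊕ Y) ⊕ W)
  on₁₂ M = M ⊕₁ id

  on₂₃ : ∀ {X Y W Y' W'} → Hom (Y ⊕ W) (Y' ⊕ W') → Hom ((X ⊕ Y) ⊕ W) ((X ⊕ Y') ⊕ W')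
  on₂₃ M = αˡ ∘ ((id ⊕₁ M) ∘ αʳ)

  swap₂₃ : ∀ {X Y W} → Hom ((X ⊕ Y) ⊕ W) ((X ⊕ W) ⊕ Y)
  swap₂₃ = on₂₃ σ

  on₁₃ : ∀ {X Y W} → Hom (X ⊕ W) (X ⊕ W) → Hom ((X ⊕ Y) ⊕ W) ((X ⊕ Y) ⊕ W)
  on₁₃ M = swap₂₃ ∘ (on₁₂ M ∘ swap₂₃)

  on₁₂ᵢ : ∀ {X Y W} → Iso (X ⊕ Y) (X ⊕ Y) → Iso ((X ⊕ Y) ⊕ W) ((X ⊕ Y) ⊕ W)
  on₁₂ᵢ φ = φ ⊕ᵢ idᵢ

  on₂₃ᵢ : ∀ {X Y W Y' W'} → Iso (Y ⊕ W) (Y' ⊕ W') → Iso ((X ⊕ Y) ⊕ W) ((X ⊕ Y') ⊕ W')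
  on₂₃ᵢ φ = symᵢ (assocᵢ _ _ _) ∘ᵢ ((idᵢ ⊕ᵢ φ) ∘ᵢ assocᵢ _ _ _)

  swap₂₃ᵢ : ∀ {X Y W} → Iso ((X ⊕ Y) ⊕ W) ((X ⊕ W) ⊕ Y)
  swap₂₃ᵢ = on₂₃ᵢ (σᵢ _ _)

  on₁₃ᵢ : ∀ {X Y W} → Iso (X ⊕ W) (X ⊕ W) → Iso ((X ⊕ Y) ⊕ W) ((X ⊕ Y) ⊕ W)
  on₁₃ᵢ φ = swap₂₃ᵢ ∘ᵢ (on₁₂ᵢ φ ∘ᵢ swap₂₃ᵢ)

  on₁₂∘⟨⟩ : ∀ {V X Y W} {M : Hom (X ⊕ Y) (X ⊕ Y)} {a a' : Hom V X} {b b' : Hom V Y}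
              {c : Hom V W} →
            M ∘ ⟨ a , b ⟩ ≈ ⟨ a' , b' ⟩ → on₁₂ M ∘ ⟨ ⟨ a , b ⟩ , c ⟩ ≈ ⟨ ⟨ a' , b' ⟩ , c ⟩
  on₁₂∘⟨⟩ p = ≈trans ⊕₁∘⟨⟩ (⟨⟩-cong p identityˡ)

  on₂₃∘⟨⟩ : ∀ {V X Y W Y' W'} {M : Hom (Y ⊕ W) (Y' ⊕ W')} {a : Hom V X} {b : Hom V Y}
              {c : Hom V W} {b' : Hom V Y'} {c' : Hom V W'} →
            M ∘ ⟨ b , c ⟩ ≈ ⟨ b' , c' ⟩ → on₂₃ M ∘ ⟨ ⟨ a , b ⟩ , c ⟩ ≈ ⟨ ⟨ a , b' ⟩ , c' ⟩
  on₂₃∘⟨⟩ p = act-∘ (act-∘ αʳ∘⟨⟩ (≈trans ⊕₁∘⟨⟩ (⟨⟩-cong identityˡ p))) αˡ∘⟨⟩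

  on₁₃∘⟨⟩ : ∀ {V X Y W} {M : Hom (X ⊕ W) (X ⊕ W)} {a a' : Hom V X} {b : Hom V Y}
              {c c' : Hom V W} →
            M ∘ ⟨ a , c ⟩ ≈ ⟨ a' , c' ⟩ → on₁₃ M ∘ ⟨ ⟨ a , b ⟩ , c ⟩ ≈ ⟨ ⟨ a' , b ⟩ , c' ⟩
  on₁₃∘⟨⟩ p = act-∘ (act-∘ (on₂₃∘⟨⟩ σ∘⟨⟩) (on₁₂∘⟨⟩ p)) (on₂₃∘⟨⟩ σ∘⟨⟩)

  -- e₃₂(N) e₂₁(M) = e₃₁(K) e₂₁(M) e₃₂(N), matrices acting on the summands of (X ⊕ Y) ⊕ W
  SteinbergRelation : ∀ {X Y W} → Hom (X ⊕ Y) (X ⊕ Y) → Hom (Y ⊕ W) (Y ⊕ W) →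
                      Hom (X ⊕ W) (X ⊕ W) → Set e
  SteinbergRelation M N K = on₂₃ N ∘ on₁₂ M ≈ on₁₃ K ∘ (on₁₂ M ∘ on₂₃ N)

  module _ {X Y W : Obj} {f : Hom X Y} {g : Hom Y W} {V : Obj}
           {a : Hom V X} {b : Hom V Y} {c : Hom V W} where

    steinberg-lhs∘⟨⟩ : (on₂₃ (elem g) ∘ on₁₂ (elem f)) ∘ ⟨ ⟨ a , b ⟩ , c ⟩
                         ≈ ⟨ ⟨ a , f ∘ a + b ⟩ , g ∘ (f ∘ a + b) + c ⟩
    steinberg-lhs∘⟨⟩ = act-∘ (on₁₂∘⟨⟩ elem∘⟨⟩) (on₂₃∘⟨⟩ elem∘⟨⟩)

    steinberg-rhs∘⟨⟩ : ∀ {h : Hom X W} →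
                       (on₁₃ (elem h) ∘ (on₁₂ (elem f) ∘ on₂₃ (elem g))) ∘ ⟨ ⟨ a , b ⟩ , c ⟩
                         ≈ ⟨ ⟨ a , f ∘ a + b ⟩ , h ∘ a + (g ∘ b + c) ⟩
    steinberg-rhs∘⟨⟩ = act-∘ (act-∘ (on₂₃∘⟨⟩ elem∘⟨⟩) (on₁₂∘⟨⟩ elem∘⟨⟩)) (on₁₃∘⟨⟩ elem∘⟨⟩)

  steinberg : ∀ {X Y W} (f : Hom X Y) (g : Hom Y W) →
              SteinbergRelation (elem f) (elem g) (elem (g ∘ f))
  steinberg {X} {Y} {W} f g = cancelʳ-id ⟨⟨π₁∘π₁,π₂∘π₁⟩,π₂⟩≈id
    (≈trans steinberg-lhs∘⟨⟩ (≈trans (⟨⟩-cong ≈refl regroup) (≈sym steinberg-rhs∘⟨⟩)))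
    where
    regroup : ∀ {V} {a : Hom V X} {b : Hom V Y} {c : Hom V W} →
              g ∘ (f ∘ a + b) + c ≈ (g ∘ f) ∘ a + (g ∘ b + c)
    regroup = ≈trans (+-cong ∘-distribˡ-+ ≈refl)
                (≈trans (G.assoc _ _ _) (+-cong (≈sym assoc) ≈refl))

  steinberg-unique : ∀ {X Y W} {f : Hom X Y} {g : Hom Y W} {h : Hom X W} →
                     SteinbergRelation (elem f) (elem g) (elem h) → h ≈ g ∘ f
  steinberg-unique {X} {f = f} {g} {h} rel = begin
      h                       ≈⟨ ≈sym (≈trans (+-cong identityʳ g∘0+0≈0) (G.identityʳ _)) ⟩
      h ∘ id + (g ∘ 0h + 0h)  ≈⟨ ⟨⟩-injectiveʳ (≈trans (≈sym steinberg-rhs∘⟨⟩)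
                                   (≈trans (∘ʳ (≈sym rel)) steinberg-lhs∘⟨⟩)) ⟩
      g ∘ (f ∘ id + 0h) + 0h  ≈⟨ ≈trans (G.identityʳ _) (∘ˡ (≈trans (G.identityʳ _) identityʳ)) ⟩
      g ∘ f                   ∎
    where
    open HR
    g∘0+0≈0 : g ∘ 0h {X} + 0h ≈ 0h
    g∘0+0≈0 = ≈trans (+-cong zeroʳ ≈refl) (G.identityˡ _)

  unitriangular⇒elem : ∀ {X Y} {M : Hom (X ⊕ Y) (X ⊕ Y)} →
                       π₁ ∘ (M ∘ ι₁) ≈ id → π₁ ∘ (M ∘ ι₂) ≈ 0h → π₂ ∘ (M ∘ ι₂) ≈ id →
                       M ≈ elem (π₂ ∘ (M ∘ ι₁))
  unitriangular⇒elem {M = M} a≈id b≈0 d≈id = ext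
    (≈trans (∘-[]-η π₁ M) (≈trans (+-cong (≈trans (∘ʳ a≈id) identityˡ) (≈trans (∘ʳ b≈0) zeroˡ))
       (≈trans (G.identityʳ _) (≈sym π₁⟨⟩))))
    (≈trans (∘-[]-η π₂ M) (≈trans (+-cong ≈refl (≈trans (∘ʳ d≈id) identityˡ)) (≈sym π₂⟨⟩)))

  lower-triangular-corner-right-inverse :
    ∀ {X Y} {M M' : Hom (X ⊕ Y) (X ⊕ Y)} → π₁ ∘ (M ∘ ι₂) ≈ 0h → M ∘ M' ≈ id →
    (π₁ ∘ (M ∘ ι₁)) ∘ (π₁ ∘ (M' ∘ ι₁)) ≈ id
  lower-triangular-corner-right-inverse {M = M} {M'} b≈0 MM'≈id = ≈sym (begin
      id                                 ≈⟨ ≈sym π₁∘ι₁ ⟩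
      π₁ ∘ ι₁                            ≈⟨ ∘ˡ (≈trans (≈sym identityˡ) (∘ʳ (≈sym MM'≈id))) ⟩
      π₁ ∘ ((M ∘ M') ∘ ι₁)               ≈⟨ ≈trans (∘ˡ assoc) (≈sym assoc) ⟩
      (π₁ ∘ M) ∘ (M' ∘ ι₁)               ≈⟨ ∘ʳ π₁∘M ⟩
      ((π₁ ∘ (M ∘ ι₁)) ∘ π₁) ∘ (M' ∘ ι₁) ≈⟨ assoc ⟩
      (π₁ ∘ (M ∘ ι₁)) ∘ (π₁ ∘ (M' ∘ ι₁)) ∎)
    where
    open HR
    π₁∘M : π₁ ∘ M ≈ (π₁ ∘ (M ∘ ι₁)) ∘ π₁
    π₁∘M = ≈trans (∘-[]-η π₁ M) (≈trans (+-cong ≈refl (≈trans (∘ʳ b≈0) zeroˡ)) (G.identityʳ _))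

  -- Evaluating the relation at ⟨⟨0,0⟩,id⟩ and ⟨⟨id,0⟩,0⟩ shows that M has upper-right entry 0,
  -- lower-right entry id and an idempotent upper-left entry, which has a right inverse, so is id.
  steinberg-elem-id⇒elem : ∀ {X Y} {M M' : Hom (X ⊕ Y) (X ⊕ Y)} →
                           SteinbergRelation M (elem id) M → M ∘ M' ≈ id →
                           M ≈ elem (π₂ ∘ (M ∘ ι₁))
  steinberg-elem-id⇒elem {X} {Y} {M} rel MM'≈id = unitriangular⇒elem
    (idempotent-split-epi⇒id (≈sym (⟨⟩-injectiveˡ (⟨⟩-injectiveˡ at-ι₁)))
      (lower-triangular-corner-right-inverse b≈0 MM'≈id))
    b≈0
    (≈trans (≈sym (⟨⟩-injectiveʳ at-ι₂)) id∘0+)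
    where
    a : Hom X X
    a = π₁ ∘ (M ∘ ι₁)
    b : Hom Y X
    b = π₁ ∘ (M ∘ ι₂)
    c : Hom X Y
    c = π₂ ∘ (M ∘ ι₁)
    d : Hom Y Y
    d = π₂ ∘ (M ∘ ι₂)

    id∘0+ : ∀ {V} {x : Hom V Y} → id ∘ 0h + x ≈ x
    id∘0+ = ≈trans (+-cong identityˡ ≈refl) (G.identityˡ _)

    evaluate : ∀ {V} {v : Hom V ((X ⊕ Y) ⊕ Y)} {l r} →
               (on₂₃ (elem id) ∘ on₁₂ M) ∘ v ≈ l → (on₁₃ M ∘ (on₁₂ M ∘ on₂₃ (elem id))) ∘ v ≈ r →
               l ≈ r
    evaluate p q = ≈trans (≈sym p) (≈trans (∘ʳ rel) q)

    M∘⟨id,0⟩ : M ∘ ⟨ id , 0h ⟩ ≈ ⟨ a , c ⟩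
    M∘⟨id,0⟩ = ≈trans (∘ˡ (≈sym ι₁-⟨⟩)) (expand _)

    M∘⟨0,0⟩ : ∀ {V} → M ∘ ⟨ 0h {V} , 0h ⟩ ≈ ⟨ 0h , 0h ⟩
    M∘⟨0,0⟩ = ≈trans (∘ˡ (≈sym 0≈⟨0,0⟩)) (≈trans zeroʳ 0≈⟨0,0⟩)

    at-ι₂ : ⟨ ⟨ 0h , 0h ⟩ , id ∘ 0h + id ⟩ ≈ ⟨ ⟨ b , 0h ⟩ , d ⟩
    at-ι₂ = evaluate (act-∘ (on₁₂∘⟨⟩ M∘⟨0,0⟩) (on₂₃∘⟨⟩ elem∘⟨⟩))
      (act-∘ (act-∘ (on₂₃∘⟨⟩ elem∘⟨⟩) (on₁₂∘⟨⟩ M∘⟨0,0⟩))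
        (on₁₃∘⟨⟩ (≈trans (∘ˡ (≈trans (⟨⟩-cong ≈refl id∘0+) (≈sym ι₂-⟨⟩))) (expand _))))

    b≈0 : b ≈ 0h
    b≈0 = ≈sym (⟨⟩-injectiveˡ (⟨⟩-injectiveˡ at-ι₂))

    M∘⟨a,0⟩ : M ∘ ⟨ a , id ∘ 0h + 0h ⟩ ≈ ⟨ a ∘ a , c ∘ a ⟩
    M∘⟨a,0⟩ = ≈trans (∘ˡ (≈trans (⟨⟩-cong (≈sym identityˡ) (≈trans id∘0+ (≈sym zeroˡ))) (≈sym ⟨⟩∘)))
                (≈trans (≈sym assoc) (≈trans (∘ʳ M∘⟨id,0⟩) ⟨⟩∘))

    at-ι₁ : ⟨ ⟨ a , c ⟩ , id ∘ c + 0h ⟩ ≈ ⟨ ⟨ a ∘ a , c ⟩ , c ∘ a ⟩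
    at-ι₁ = evaluate (act-∘ (on₁₂∘⟨⟩ M∘⟨id,0⟩) (on₂₃∘⟨⟩ elem∘⟨⟩))
      (act-∘ (act-∘ (on₂₃∘⟨⟩ elem∘⟨⟩) (on₁₂∘⟨⟩ M∘⟨id,0⟩)) (on₁₃∘⟨⟩ M∘⟨a,0⟩))

module CoreFunctor {o ℓ e o' ℓ' e' : Level}
                   {𝒜 : AdditiveCategory o ℓ e} {ℬ : AdditiveCategory o' ℓ' e'}
                   (F : SymMonCoreFunctor 𝒜 ℬ) where
  private
    module A = Biproducts 𝒜
  open Biproducts ℬ
  open SymMonCoreFunctor F

  μ⇒ : ∀ X Y → Hom (F₀ X ⊕ F₀ Y) (F₀ (X A.⊕ Y))
  μ⇒ X Y = Iso.from (μ X Y)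

  μ⇐ : ∀ X Y → Hom (F₀ (X A.⊕ Y)) (F₀ X ⊕ F₀ Y)
  μ⇐ X Y = Iso.to (μ X Y)

  μ⇐∘μ⇒ : ∀ {X Y} → μ⇐ X Y ∘ μ⇒ X Y ≈ id
  μ⇐∘μ⇒ {X} {Y} = Iso.isoˡ (μ X Y)

  μ⇒∘μ⇐ : ∀ {X Y} → μ⇒ X Y ∘ μ⇐ X Y ≈ id
  μ⇒∘μ⇐ {X} {Y} = Iso.isoʳ (μ X Y)

  F₁-symᵢ∘F₁ : ∀ {X Y} (φ : A.Iso X Y) → F₁ (A.symᵢ φ) ∘ F₁ φ ≈ id
  F₁-symᵢ∘F₁ φ = ≈trans (≈sym (F-∘ (A.symᵢ φ) φ)) (≈trans (F-resp (A.Iso.isoˡ φ)) F-id)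

  F₁∘F₁-symᵢ : ∀ {X Y} (φ : A.Iso X Y) → F₁ φ ∘ F₁ (A.symᵢ φ) ≈ id
  F₁∘F₁-symᵢ φ = ≈trans (≈sym (F-∘ φ (A.symᵢ φ))) (≈trans (F-resp (A.Iso.isoʳ φ)) F-id)

  Represents : ∀ {S T V V'} → A.Iso S T → Hom V (F₀ S) → Hom V' (F₀ T) → Hom V V' → Set e'
  Represents φ P P' x = F₁ φ ∘ P ≈ P' ∘ x

  represents-resp : ∀ {S T V V'} {φ φ' : A.Iso S T} {P Q : Hom V (F₀ S)}
                      {P' Q' : Hom V' (F₀ T)} {x y : Hom V V'} →
                    A.Iso.from φ A.≈ A.Iso.from φ' → P ≈ Q → P' ≈ Q' → x ≈ y →
                    Represents φ P P' x → Represents φ' Q Q' y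
  represents-resp φ≈φ' P≈Q P'≈Q' x≈y r =
    ≈trans (∘-resp-≈ (≈sym (F-resp φ≈φ')) (≈sym P≈Q)) (≈trans r (∘-resp-≈ P'≈Q' x≈y))

  represents-id : ∀ {S V} {P : Hom V (F₀ S)} → Represents A.idᵢ P P id
  represents-id = ≈trans (∘ʳ F-id) (≈trans identityˡ (≈sym identityʳ))

  represents-F₁ : ∀ {S T} {φ : A.Iso S T} → Represents φ id id (F₁ φ)
  represents-F₁ = ≈trans identityʳ (≈sym identityˡ)

  represents-∘ : ∀ {S T U V V' V''} {ψ : A.Iso T U} {φ : A.Iso S T} {P : Hom V (F₀ S)}
                   {P' : Hom V' (F₀ T)} {P'' : Hom V'' (F₀ U)} {y : Hom V' V''} {x : Hom V V'} →
                 Represents ψ P' P'' y → Represents φ P P' x → Represents (ψ A.∘ᵢ φ) P P'' (y ∘ x)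
  represents-∘ {ψ = ψ} {φ} rψ rφ =
    ≈trans (∘ʳ (F-∘ ψ φ)) (≈trans assoc (≈trans (∘ˡ rφ)
      (≈trans (≈sym assoc) (≈trans (∘ʳ rψ) assoc))))

  represents-⊕ : ∀ {S T S' T' V V' U U'} {φ : A.Iso S T} {ψ : A.Iso S' T'}
                   {P : Hom V (F₀ S)} {P' : Hom V' (F₀ T)} {Q : Hom U (F₀ S')}
                   {Q' : Hom U' (F₀ T')} {x : Hom V V'} {y : Hom U U'} →
                 Represents φ P P' x → Represents ψ Q Q' y →
                 Represents (φ A.⊕ᵢ ψ) (μ⇒ S S' ∘ (P ⊕₁ Q)) (μ⇒ T T' ∘ (P' ⊕₁ Q')) (x ⊕₁ y)
  represents-⊕ {φ = φ} {ψ} rφ rψ =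
    ≈trans (extendʳ (μ-natural φ ψ))
      (≈trans (∘ˡ (≈trans ⊕₁-∘ (≈trans (⊕₁-cong rφ rψ) (≈sym ⊕₁-∘)))) (≈sym assoc))

  represents-symᵢ : ∀ {S T V V'} {φ : A.Iso S T} {P : Hom V (F₀ S)} {P' : Hom V' (F₀ T)}
                      {x : Hom V V'} {y : Hom V' V} →
                    Represents φ P P' x → x ∘ y ≈ id → Represents (A.symᵢ φ) P' P y
  represents-symᵢ {φ = φ} {P} {P'} {x} {y} r xy≈id = begin
      F₁ (A.symᵢ φ) ∘ P'                ≈⟨ ∘ˡ (≈trans (≈sym identityʳ) (∘ˡ (≈sym xy≈id))) ⟩
      F₁ (A.symᵢ φ) ∘ (P' ∘ (x ∘ y))    ≈⟨ ∘ˡ (≈trans (≈sym assoc) (∘ʳ (≈sym r))) ⟩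
      F₁ (A.symᵢ φ) ∘ ((F₁ φ ∘ P) ∘ y)  ≈⟨ ∘ˡ assoc ⟩
      F₁ (A.symᵢ φ) ∘ (F₁ φ ∘ (P ∘ y))  ≈⟨ cancelˡ (F₁-symᵢ∘F₁ φ) ⟩
      P ∘ y                             ∎
    where open HR

  represents-unique : ∀ {S T V V'} {φ φ' : A.Iso S T} {P : Hom V (F₀ S)} {P' : Hom V' (F₀ T)}
                        {x y : Hom V V'} (P'⁻¹ : Hom (F₀ T) V') → P'⁻¹ ∘ P' ≈ id →
                      A.Iso.from φ A.≈ A.Iso.from φ' →
                      Represents φ P P' x → Represents φ' P P' y → x ≈ y
  represents-unique {P' = P'} {x} {y} P'⁻¹ retraction φ≈φ' rx ry = begin
      x                    ≈⟨ ≈sym (cancelˡ retraction) ⟩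
      P'⁻¹ ∘ (P' ∘ x)      ≈⟨ ∘ˡ (≈trans (≈sym rx) (≈trans (∘ʳ (F-resp φ≈φ')) ry)) ⟩
      P'⁻¹ ∘ (P' ∘ y)      ≈⟨ cancelˡ retraction ⟩
      y                    ∎
    where open HR

  represents-change-coordinates :
    ∀ {S T V V' U U'} {φ : A.Iso S T} {P : Hom V (F₀ S)} {P' : Hom V' (F₀ T)}
      {x : Hom V V'} {k : Hom U V} {k' : Hom U' V'} {l' : Hom V' U'} →
    Represents φ P P' x → k' ∘ l' ≈ id → Represents φ (P ∘ k) (P' ∘ k') (l' ∘ (x ∘ k))
  represents-change-coordinates r k'l'≈id = ≈trans (≈sym assoc) (≈trans (∘ʳ r)
    (≈trans assoc (≈trans (∘ˡ (≈sym (cancelˡ k'l'≈id))) (≈sym assoc))))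

  μˡ₃ : ∀ X Y W → Hom ((F₀ X ⊕ F₀ Y) ⊕ F₀ W) (F₀ ((X A.⊕ Y) A.⊕ W))
  μˡ₃ X Y W = μ⇒ (X A.⊕ Y) W ∘ (μ⇒ X Y ⊕₁ id)

  μʳ₃ : ∀ X Y W → Hom (F₀ X ⊕ (F₀ Y ⊕ F₀ W)) (F₀ (X A.⊕ (Y A.⊕ W)))
  μʳ₃ X Y W = μ⇒ X (Y A.⊕ W) ∘ (id ⊕₁ μ⇒ Y W)

  μˡ₃-retraction : ∀ {X Y W} → ((μ⇐ X Y ⊕₁ id) ∘ μ⇐ (X A.⊕ Y) W) ∘ μˡ₃ X Y W ≈ id
  μˡ₃-retraction = ≈trans assoc (≈trans (∘ˡ (cancelˡ μ⇐∘μ⇒))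
    (≈trans ⊕₁-∘ (≈trans (⊕₁-cong μ⇐∘μ⇒ identityˡ) ⊕₁-id)))

  represents-σ : ∀ X Y → Represents (A.σᵢ X Y) (μ⇒ X Y) (μ⇒ Y X) σ
  represents-σ = braid-coh

  represents-α : ∀ X Y W → Represents (A.assocᵢ X Y W) (μˡ₃ X Y W) (μʳ₃ X Y W) αʳ
  represents-α X Y W = ≈trans (assoc-coh X Y W) (≈sym assoc)

  represents-α⁻¹ : ∀ X Y W → Represents (A.symᵢ (A.assocᵢ X Y W)) (μʳ₃ X Y W) (μˡ₃ X Y W) αˡ
  represents-α⁻¹ X Y W = represents-symᵢ (represents-α X Y W) (Iso.isoʳ (assocᵢ _ _ _))

  module _ {X Y W : A.Obj} where

    represents-on₁₂ : ∀ {φ : A.Iso (X A.⊕ Y) (X A.⊕ Y)} {M} →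
                      Represents φ (μ⇒ X Y) (μ⇒ X Y) M →
                      Represents (A.on₁₂ᵢ φ) (μˡ₃ X Y W) (μˡ₃ X Y W) (on₁₂ M)
    represents-on₁₂ r = represents-⊕ r represents-id

    represents-on₂₃ : ∀ {Y' W'} {φ : A.Iso (Y A.⊕ W) (Y' A.⊕ W')} {M} →
                      Represents φ (μ⇒ Y W) (μ⇒ Y' W') M →
                      Represents (A.on₂₃ᵢ φ) (μˡ₃ X Y W) (μˡ₃ X Y' W') (on₂₃ M)
    represents-on₂₃ r = represents-∘ (represents-α⁻¹ _ _ _)
      (represents-∘ (represents-⊕ (represents-id {P = id}) r) (represents-α X Y W))

  represents-on₁₃ : ∀ {X Y W} {φ : A.Iso (X A.⊕ W) (X A.⊕ W)} {M} →
                    Represents φ (μ⇒ X W) (μ⇒ X W) M →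
                    Represents (A.on₁₃ᵢ {Y = Y} φ) (μˡ₃ X Y W) (μˡ₃ X Y W) (on₁₃ M)
  represents-on₁₃ r = represents-∘ (represents-on₂₃ (represents-σ _ _))
    (represents-∘ (represents-on₁₂ r) (represents-on₂₃ (represents-σ _ _)))

  steinberg-transport : ∀ {X Y W} {f : A.Hom X Y} {g : A.Hom Y W} {M N K} →
                        Represents (A.elemᵢ f) (μ⇒ X Y) (μ⇒ X Y) M →
                        Represents (A.elemᵢ g) (μ⇒ Y W) (μ⇒ Y W) N →
                        Represents (A.elemᵢ (g A.∘ f)) (μ⇒ X W) (μ⇒ X W) K →
                        SteinbergRelation M N K
  steinberg-transport {f = f} {g} rM rN rK = represents-unique _ μˡ₃-retraction
    (A.steinberg f g)
    (represents-∘ (represents-on₂₃ rN) (represents-on₁₂ rM))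
    (represents-∘ (represents-on₁₃ rK) (represents-∘ (represents-on₁₂ rM) (represents-on₂₃ rN)))

  μ-conj : ∀ {X Y} → A.Iso (X A.⊕ Y) (X A.⊕ Y) → Hom (F₀ X ⊕ F₀ Y) (F₀ X ⊕ F₀ Y)
  μ-conj {X} {Y} φ = μ⇐ X Y ∘ (F₁ φ ∘ μ⇒ X Y)

  represents-μ-conj : ∀ {X Y} (φ : A.Iso (X A.⊕ Y) (X A.⊕ Y)) →
                      Represents φ (μ⇒ X Y) (μ⇒ X Y) (μ-conj φ)
  represents-μ-conj φ = ≈sym (cancelˡ μ⇒∘μ⇐)

  μ-conj∘μ-conj-symᵢ : ∀ {X Y} (φ : A.Iso (X A.⊕ Y) (X A.⊕ Y)) →
                       μ-conj φ ∘ μ-conj (A.symᵢ φ) ≈ id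
  μ-conj∘μ-conj-symᵢ {X} {Y} φ = represents-unique (μ⇐ X Y) μ⇐∘μ⇒ (A.Iso.isoʳ φ)
    (represents-∘ (represents-μ-conj φ) (represents-μ-conj (A.symᵢ φ))) represents-id

  F̃₁ : ∀ {X Y} → A.Hom X Y → Hom (F₀ X) (F₀ Y)
  F̃₁ f = π₂ ∘ (μ-conj (A.elemᵢ f) ∘ ι₁)

  F̃₁-resp : ∀ {X Y} {f g : A.Hom X Y} → f A.≈ g → F̃₁ f ≈ F̃₁ g
  F̃₁-resp f≈g = ∘ˡ (∘ʳ (∘ˡ (∘ʳ (F-resp (A.elem-cong f≈g)))))

  F̃₁-from-representation : ∀ {X Y} {f : A.Hom X Y} {x : Hom (F₀ X) (F₀ Y)} →
                           Represents (A.elemᵢ f) (μ⇒ X Y) (μ⇒ X Y) (elem x) → F̃₁ f ≈ x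
  F̃₁-from-representation {X} {Y} r = ≈trans
    (∘ˡ (∘ʳ (represents-unique (μ⇐ X Y) μ⇐∘μ⇒ A.≈refl (represents-μ-conj _) r)))
    π₂∘elem∘ι₁

  module _ (E : Extension 𝒜 ℬ F) where
    open Extension E

    map∘μ⇒ : ∀ {X Y Z} (h : A.Hom (X A.⊕ Y) Z) →
             map h ∘ μ⇒ X Y ≈ [ map (h A.∘ A.ι₁) , map (h A.∘ A.ι₂) ]
    map∘μ⇒ {X} {Y} h = ≈trans (∘ˡ (≈sym (map-μ X Y)))
      (≈trans ∘[] ([]-cong (≈sym (map-∘ _ _)) (≈sym (map-∘ _ _))))

    map-0 : ∀ {X Y} → map (A.0h {X} {Y}) ≈ 0h
    map-0 = GP.identityˡ-unique _ _ (≈trans (≈sym (map-+ A.0h A.0h)) (map-resp (A.G.identityˡ _)))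

    map-π₂ : ∀ {X Y} → map (A.π₂ {X} {Y}) ≈ π₂ ∘ μ⇐ X Y
    map-π₂ {X} {Y} = begin
        map A.π₂                          ≈⟨ ≈sym (cancelʳ μ⇒∘μ⇐) ⟩
        (map A.π₂ ∘ μ⇒ X Y) ∘ μ⇐ X Y      ≈⟨ ∘ʳ (map∘μ⇒ A.π₂) ⟩
        [ map (A.π₂ A.∘ A.ι₁) , map (A.π₂ A.∘ A.ι₂) ] ∘ μ⇐ X Y
          ≈⟨ ∘ʳ ([]-cong (≈trans (map-resp A.π₂∘ι₁) map-0) (≈trans (map-resp A.π₂∘ι₂) map-id)) ⟩
        [ 0h , id ] ∘ μ⇐ X Y              ≈⟨ ∘ʳ (≈trans (+-cong zeroˡ identityˡ) (G.identityˡ _)) ⟩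
        π₂ ∘ μ⇐ X Y                       ∎
      where open HR

    map≈F̃₁ : ∀ {X Y} (f : A.Hom X Y) → map f ≈ F̃₁ f
    map≈F̃₁ {X} {Y} f = begin
        map f                                              ≈⟨ map-resp (A.≈sym A.π₂∘elem∘ι₁) ⟩
        map (A.π₂ A.∘ (A.elem f A.∘ A.ι₁))                  ≈⟨ ≈trans (map-∘ _ _) (∘ˡ (map-∘ _ _)) ⟩
        map A.π₂ ∘ (map (A.elem f) ∘ map A.ι₁)
          ≈⟨ ∘-resp-≈ map-π₂ (∘-resp-≈ (map-iso (A.elemᵢ f)) μ⇒∘ι₁) ⟩
        (π₂ ∘ μ⇐ X Y) ∘ (F₁ (A.elemᵢ f) ∘ (μ⇒ X Y ∘ ι₁))
          ≈⟨ ≈trans assoc (∘ˡ (≈trans (∘ˡ (≈sym assoc)) (≈sym assoc))) ⟩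
        F̃₁ f                                               ∎
      where
      open HR
      μ⇒∘ι₁ : map A.ι₁ ≈ μ⇒ X Y ∘ ι₁
      μ⇒∘ι₁ = ≈sym (≈trans (∘ʳ (≈sym (map-μ X Y))) []∘ι₁)

    extension⇒shear-condition : ShearCondition 𝒜 ℬ F
    extension⇒shear-condition X = begin
        F₁ (A.shearᵢ X) ∘ μ⇒ X X                               ≈⟨ ∘ʳ (≈sym (map-iso (A.shearᵢ X))) ⟩
        map A.shear ∘ μ⇒ X X                                   ≈⟨ map∘μ⇒ A.shear ⟩
        [ map (A.shear A.∘ A.ι₁) , map (A.shear A.∘ A.ι₂) ]
          ≈⟨ []-cong (map-resp A.shear∘ι₁) (≈trans (map-resp A.shear∘ι₂) (map-+ _ _)) ⟩
        [ map A.ι₁ , map A.ι₁ + map A.ι₂ ]                     ≈⟨ ≈sym []∘shear ⟩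
        [ map A.ι₁ , map A.ι₂ ] ∘ shear                        ≈⟨ ∘ʳ (map-μ X X) ⟩
        μ⇒ X X ∘ shear                                         ∎
      where open HR

  module _ (shear-condition : ShearCondition 𝒜 ℬ F) where

    -- The shear condition enters only here: conjugated by σ, it says that F (elem id) is
    -- elem id in the coordinates μ.
    represents-elem-id : ∀ X → Represents (A.elemᵢ (A.id {X})) (μ⇒ X X) (μ⇒ X X) (elem id)
    represents-elem-id X = represents-resp A.σ∘shear∘σ ≈refl ≈refl σ∘shear∘σ
      (represents-∘ (represents-σ X X)
        (represents-∘ {φ = A.σᵢ X X} (shear-condition X) (represents-σ X X)))

    μ-conj-elem : ∀ {X Y} (f : A.Hom X Y) → μ-conj (A.elemᵢ f) ≈ elem (F̃₁ f)
    μ-conj-elem {X} {Y} f = steinberg-elem-id⇒elem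
      (steinberg-transport (represents-μ-conj _) (represents-elem-id Y)
        (represents-resp (A.elem-cong (A.≈sym A.identityˡ)) ≈refl ≈refl ≈refl
          (represents-μ-conj _)))
      (μ-conj∘μ-conj-symᵢ (A.elemᵢ f))

    represents-elem : ∀ {X Y} (f : A.Hom X Y) →
                      Represents (A.elemᵢ f) (μ⇒ X Y) (μ⇒ X Y) (elem (F̃₁ f))
    represents-elem f = represents-resp A.≈refl ≈refl ≈refl (μ-conj-elem f) (represents-μ-conj _)

    F̃₁-+ : ∀ {X Y} (f g : A.Hom X Y) → F̃₁ (f A.+ g) ≈ F̃₁ f + F̃₁ g
    F̃₁-+ f g = F̃₁-from-representation (represents-resp A.elem-+ ≈refl ≈refl elem-+
      (represents-∘ (represents-elem f) (represents-elem g)))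

    F̃₁-∘ : ∀ {X Y Z} (g : A.Hom Y Z) (f : A.Hom X Y) → F̃₁ (g A.∘ f) ≈ F̃₁ g ∘ F̃₁ f
    F̃₁-∘ g f = steinberg-unique
      (steinberg-transport (represents-elem f) (represents-elem g) (represents-elem (g A.∘ f)))

    represents-id⊕F₁ : ∀ {X S T} (φ : A.Iso S T) →
                       Represents (A.idᵢ {X} A.⊕ᵢ φ) (μ⇒ X S) (μ⇒ X T) (id ⊕₁ F₁ φ)
    represents-id⊕F₁ {X} φ = represents-resp A.≈refl μ⇒∘id⊕id μ⇒∘id⊕id ≈refl
      (represents-⊕ (represents-id {P = id}) represents-F₁)
      where
      μ⇒∘id⊕id : ∀ {Z} → μ⇒ X Z ∘ (id ⊕₁ id) ≈ μ⇒ X Z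
      μ⇒∘id⊕id = ≈trans (∘ˡ ⊕₁-id) identityʳ

    F̃₁-iso : ∀ {X Y} (i : A.Iso X Y) → F̃₁ (A.Iso.from i) ≈ F₁ i
    F̃₁-iso {X} i = ≈trans (F̃₁-from-representation (represents-resp
        (A.≈trans (A.elem-conj (A.Iso.isoʳ i)) (A.elem-cong A.identityʳ)) ≈refl ≈refl
        (elem-conj (F₁∘F₁-symᵢ i))
        (represents-∘ (represents-id⊕F₁ i)
          (represents-∘ (represents-elem-id X) (represents-id⊕F₁ (A.symᵢ i))))))
      identityʳ

    F̃₁-id : ∀ {X} → F̃₁ (A.id {X}) ≈ id
    F̃₁-id = ≈trans (F̃₁-iso A.idᵢ) F-id

    F̃₁-ι₁ : ∀ {X Y} → F̃₁ (A.ι₁ {X} {Y}) ≈ μ⇒ X Y ∘ ι₁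
    F̃₁-ι₁ {X} {Y} = F̃₁-from-representation (represents-resp (A.≈sym A.elem-ι₁)
        μʳ₃∘id⊕μ⇐ μʳ₃∘id⊕μ⇐ (≈trans (∘ˡ (∘ʳ (≈sym elem-ι₁))) (elem-conj μ⇒∘μ⇐))
        (represents-change-coordinates
          (represents-∘ (represents-α X X Y)
            (represents-∘ (represents-on₁₂ (represents-elem-id X)) (represents-α⁻¹ X X Y)))
          (id⊕-inverse μ⇐∘μ⇒)))
      where
      id⊕-inverse : ∀ {U V} {k : Hom U V} {l : Hom V U} →
                    k ∘ l ≈ id → (id {F₀ X} ⊕₁ k) ∘ (id ⊕₁ l) ≈ id
      id⊕-inverse kl≈id = ≈trans ⊕₁-∘ (≈trans (⊕₁-cong identityˡ kl≈id) ⊕₁-id)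
      μʳ₃∘id⊕μ⇐ : μʳ₃ X X Y ∘ (id ⊕₁ μ⇐ X Y) ≈ μ⇒ X (X A.⊕ Y)
      μʳ₃∘id⊕μ⇐ = cancelʳ (id⊕-inverse μ⇒∘μ⇐)

    F̃₁-ι₂ : ∀ {X Y} → F̃₁ (A.ι₂ {X} {Y}) ≈ μ⇒ X Y ∘ ι₂
    F̃₁-ι₂ {X} {Y} = begin
        F̃₁ A.ι₂                         ≈⟨ F̃₁-resp (A.≈sym A.σ∘ι₁) ⟩
        F̃₁ (A.σ A.∘ A.ι₁)               ≈⟨ F̃₁-∘ _ _ ⟩
        F̃₁ A.σ ∘ F̃₁ A.ι₁                ≈⟨ ∘-resp-≈ (F̃₁-iso (A.σᵢ Y X)) F̃₁-ι₁ ⟩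
        F₁ (A.σᵢ Y X) ∘ (μ⇒ Y X ∘ ι₁)   ≈⟨ extendʳ (represents-σ Y X) ⟩
        μ⇒ X Y ∘ (σ ∘ ι₁)               ≈⟨ ∘ˡ σ∘ι₁ ⟩
        μ⇒ X Y ∘ ι₂                     ∎
      where open HR

    shear-condition⇒extension : Extension 𝒜 ℬ F
    shear-condition⇒extension = record
      { map      = F̃₁
      ; map-resp = F̃₁-resp
      ; map-id   = F̃₁-id
      ; map-∘    = F̃₁-∘
      ; map-+    = F̃₁-+
      ; map-iso  = F̃₁-iso
      ; map-μ    = λ X Y → ≈trans ([]-cong F̃₁-ι₁ F̃₁-ι₂) (≈sym ([]-η (μ⇒ X Y)))
      }

module MonNatIsoLift {o ℓ e o' ℓ' e' : Level}
                     {𝒜 : AdditiveCategory o ℓ e} {ℬ : AdditiveCategory o' ℓ' e'}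
                     {F G : SymMonCoreFunctor 𝒜 ℬ} (η : MonNatIso 𝒜 ℬ F G) where
  private
    module A = Biproducts 𝒜
    module F = CoreFunctor F
    module G = CoreFunctor G
  open Biproducts ℬ
  open MonNatIso η using (natural; η-μ)

  η⇒ : ∀ X → Hom (SymMonCoreFunctor.F₀ F X) (SymMonCoreFunctor.F₀ G X)
  η⇒ X = Iso.from (MonNatIso.η η X)

  μ⇐-η : ∀ X Y → G.μ⇐ X Y ∘ η⇒ (X A.⊕ Y) ≈ (η⇒ X ⊕₁ η⇒ Y) ∘ F.μ⇐ X Y
  μ⇐-η X Y = begin
      G.μ⇐ X Y ∘ η⇒ (X A.⊕ Y)                             ≈⟨ ∘ˡ (≈sym (cancelʳ F.μ⇒∘μ⇐)) ⟩
      G.μ⇐ X Y ∘ ((η⇒ (X A.⊕ Y) ∘ F.μ⇒ X Y) ∘ F.μ⇐ X Y)   ≈⟨ ∘ˡ (≈trans (∘ʳ (η-μ X Y)) assoc) ⟩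
      G.μ⇐ X Y ∘ (G.μ⇒ X Y ∘ ((η⇒ X ⊕₁ η⇒ Y) ∘ F.μ⇐ X Y)) ≈⟨ cancelˡ G.μ⇐∘μ⇒ ⟩
      (η⇒ X ⊕₁ η⇒ Y) ∘ F.μ⇐ X Y                           ∎
    where open HR

  μ-conj-η : ∀ {X Y} (φ : A.Iso (X A.⊕ Y) (X A.⊕ Y)) →
             G.μ-conj φ ∘ (η⇒ X ⊕₁ η⇒ Y) ≈ (η⇒ X ⊕₁ η⇒ Y) ∘ F.μ-conj φ
  μ-conj-η {X} {Y} φ = begin
      G.μ-conj φ ∘ (η⇒ X ⊕₁ η⇒ Y)                                ≈⟨ ≈trans assoc (∘ˡ assoc) ⟩
      G.μ⇐ X Y ∘ (G₁ φ ∘ (G.μ⇒ X Y ∘ (η⇒ X ⊕₁ η⇒ Y)))            ≈⟨ ∘ˡ (∘ˡ (≈sym (η-μ X Y))) ⟩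
      G.μ⇐ X Y ∘ (G₁ φ ∘ (η⇒ (X A.⊕ Y) ∘ F.μ⇒ X Y))              ≈⟨ ∘ˡ (extendʳ (natural φ)) ⟩
      G.μ⇐ X Y ∘ (η⇒ (X A.⊕ Y) ∘ (F₁ φ ∘ F.μ⇒ X Y))              ≈⟨ extendʳ (μ⇐-η X Y) ⟩
      (η⇒ X ⊕₁ η⇒ Y) ∘ F.μ-conj φ                                ∎
    where
    open HR
    open SymMonCoreFunctor F using (F₁)
    open SymMonCoreFunctor G using () renaming (F₁ to G₁)

  F̃₁-natural : ∀ {X Y} (f : A.Hom X Y) → G.F̃₁ f ∘ η⇒ X ≈ η⇒ Y ∘ F.F̃₁ f
  F̃₁-natural {X} {Y} f = begin
      (π₂ ∘ (G.μ-conj (A.elemᵢ f) ∘ ι₁)) ∘ η⇒ X                  ≈⟨ ≈trans assoc (∘ˡ assoc) ⟩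
      π₂ ∘ (G.μ-conj (A.elemᵢ f) ∘ (ι₁ ∘ η⇒ X))                  ≈⟨ ∘ˡ (∘ˡ (≈sym ⊕₁∘ι₁)) ⟩
      π₂ ∘ (G.μ-conj (A.elemᵢ f) ∘ ((η⇒ X ⊕₁ η⇒ Y) ∘ ι₁))        ≈⟨ ∘ˡ (extendʳ (μ-conj-η _)) ⟩
      π₂ ∘ ((η⇒ X ⊕₁ η⇒ Y) ∘ (F.μ-conj (A.elemᵢ f) ∘ ι₁))        ≈⟨ π₂∘⊕₁ ⟩
      η⇒ Y ∘ F.F̃₁ f                                             ∎
    where open HR

  lift : (E : Extension 𝒜 ℬ F) (E' : Extension 𝒜 ℬ G) → NatIsoExt 𝒜 ℬ E E'
  lift E E' = record
    { β       = MonNatIso.η η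
    ; natural = λ f → ≈trans (∘ʳ (G.map≈F̃₁ E' f))
                        (≈trans (F̃₁-natural f) (∘ˡ (≈sym (F.map≈F̃₁ E f))))
    }

lemma8p11 : ∀ {o ℓ e o' ℓ' e'}
              (𝒜 : AdditiveCategory o ℓ e) (ℬ : AdditiveCategory o' ℓ' e') →
    -- (1) F extends to an additive functor iff the shear condition holds
    ((F : SymMonCoreFunctor 𝒜 ℬ) →
        (Extension 𝒜 ℬ F → ShearCondition 𝒜 ℬ F)
      × (ShearCondition 𝒜 ℬ F → Extension 𝒜 ℬ F))
    -- (2) the extension is unique
    × ((F : SymMonCoreFunctor 𝒜 ℬ) (E₁ E₂ : Extension 𝒜 ℬ F) →
       ∀ {X Y} (f : AdditiveCategory.Hom 𝒜 X Y) →
       AdditiveCategory._≈_ ℬ (Extension.map E₁ f) (Extension.map E₂ f))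
    -- (3) isomorphisms F ≅ G lift uniquely to isomorphisms F̃ ≅ G̃
    × ((F G : SymMonCoreFunctor 𝒜 ℬ) (η : MonNatIso 𝒜 ℬ F G)
       (E : Extension 𝒜 ℬ F) (E' : Extension 𝒜 ℬ G) →
       Σ (NatIsoExt 𝒜 ℬ E E') (λ β →
           IsLiftOf 𝒜 ℬ β η
         × ((β' : NatIsoExt 𝒜 ℬ E E') → IsLiftOf 𝒜 ℬ β' η →
            ∀ X → AdditiveCategory._≈_ ℬ
                    (AddCat.Iso.from (NatIsoExt.β β' X))
                    (AddCat.Iso.from (NatIsoExt.β β X)))))
lemma8p11 𝒜 ℬ =
    (λ F → CoreFunctor.extension⇒shear-condition F , CoreFunctor.shear-condition⇒extension F)
  , (λ F E₁ E₂ f → ≈trans (CoreFunctor.map≈F̃₁ F E₁ f) (≈sym (CoreFunctor.map≈F̃₁ F E₂ f)))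
  , (λ F G η E E' → MonNatIsoLift.lift η E E' , (λ X → ≈refl) , (λ β' β'-lifts-η → β'-lifts-η))
  where open AddCat ℬ using (≈refl; ≈sym; ≈trans)
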